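{- Suppose $\mathcal A\supseteq\{1,2,3\}$ and $P=\{p,q\}$. For every $k\ge2$ there exist $\delta^k_{cou}\in D^P_k(\mathsf{S5}_n\mathbf D)$ and an $\mathsf{S5}_n\mathbf D$-model $(M',s')$ with $M',s'\models(\delta^k_{cou})^p$ such that there is no $\mathsf{K45}_n\mathbf D$-model $(M,s)$ for which both $M,s\models\delta^k_{cou}$ and $(M,s)$ is collectively $p$-bisimilar to $(M',s')$. Consequently, for each $\mathsf L$ among $\mathsf{K45}_n\mathbf D$, $\mathsf{KD45}_n\mathbf D$, $\mathsf{S5}_n\mathbf D$, $(\delta^k_{cou})^p$ is not a result of forgetting $p$ in $\delta^k_{cou}$ in $\mathsf L$.
   Context: $\mathcal A$ is a finite set of $n$ agents, $\mathcal P$ a countable set of atoms, $\mathcal P^+(\mathcal A)$ the nonempty subsets of $\mathcal A$. Models $(S,R,V)$: $\mathbf D_{\mathcal B}$ is the box for $R_{\mathcal B}=\bigcap_{i\in\mathcal B}R_i$, $\hat{\mathbf D}_{\mathcal B}=\neg\mathbf D_{\mathcal B}\neg$. $\mathsf{K45}_n\mathbf D$-, $\mathsf{KD45}_n\mathbf D$-, $\mathsf{S5}_n\mathbf D$-models are models whose relations $R_i$ are respectively transitive and Euclidean; serial, transitive and Euclidean; reflexive, transitive and Euclidean. $\nabla_{\mathcal B}\Phi=\mathbf D_{\mathcal B}(\bigvee\Phi)\wedge\bigwedge\{\hat{\mathbf D}_{\mathcal B}\phi\mid\phi\in\Phi\}$. $D^P_0$: minterms of $P$; $D^P_{k+1}$: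 formulas $\delta_0\wedge\bigwedge_{\mathcal B\in\mathcal P^+(\mathcal A)}\nabla_{\mathcal B}\Phi_{\mathcal B}$ with $\delta_0\in D^P_0$, $\Phi_{\mathcal B}\subseteq D^P_k$; $D^P_k(\mathsf L)$: those satisfiable in some $\mathsf L$-model. $\delta^p$: replace every occurrence of $\neg p$ in $\delta$ by $\top$, then every remaining $p$ by $\top$. Collective $p$-bisimilarity of $(M,s),(M',s')$: a relation $\rho\ni(s,s')$ such that related worlds agree on atoms other than $p$ and for each $\mathcal C\in\mathcal P^+(\mathcal A)$ every $R_{\mathcal C}$-successor of one related world is $\rho$-related to an $R'_{\mathcal C}$-successor of the other, and vice versa. $\psi$ (atoms among those of $\phi$ except $p$) is a result of forgetting $p$ in $\phi$ in $\mathsf L$ if every $\mathsf L$-model collectively $p$-bisimilar to an $\mathsf L$-model of $\phi$ satisfies $\psi$, and every $\mathsf L$-model of $\psi$ is collectively $p$-bisimilar to some $\mathsf L$-model of $\phi$. -}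

module Defs where

open import Data.Nat using (ℕ; zero; suc; _≟_)
open import Data.Bool using (Bool; true; false; if_then_else_)
open import Data.Fin using (Fin)
open import Data.Fin.Subset using (Subset; _∈_; Nonempty)
open import Data.Fin.Subset.Properties using (nonempty?)
open import Data.Vec using (Vec; []; _∷_)
open import Data.List using (List; []; _∷_; map; foldr; filter; _++_)
open import Data.List.Relation.Unary.All using (All)
open import Data.Product using (Σ; _×_; _,_)
open import Data.Sum using (_⊎_)
open import Data.Unit using (⊤)
open import Data.Empty using (⊥)
open import Relation.Nullary using (¬_; yes; no)
open import Relation.Binary.PropositionalEquality using (_≡_; _≢_)

-- Agents are Fin n; coalitions are subsets of Fin n (the language only
-- uses nonempty ones); atoms are natural numbers (countable set 𝒫).

data Form (n : ℕ) : Set where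
  atom : ℕ → Form n
  top  : Form n
  bot  : Form n
  neg  : Form n → Form n
  _∧ᶠ_ : Form n → Form n → Form n
  _∨ᶠ_ : Form n → Form n → Form n
  D    : Subset n → Form n → Form n

Dhat : ∀ {n} → Subset n → Form n → Form n
Dhat B φ = neg (D B (neg φ))

⋀ : ∀ {n} → List (Form n) → Form n
⋀ = foldr _∧ᶠ_ top

⋁ : ∀ {n} → List (Form n) → Form n
⋁ = foldr _∨ᶠ_ bot

allSubsets : ∀ n → List (Subset n)
allSubsets zero    = [] ∷ []
allSubsets (suc n) = map (true ∷_) (allSubsets n) ++ map (false ∷_) (allSubsets n)

coalitions : ∀ n → List (Subset n)
coalitions n = filter nonempty? (allSubsets n)

∇ : ∀ {n} → Subset n → List (Form n) → Form n
∇ B Φ = D B (⋁ Φ) ∧ᶠ ⋀ (map (Dhat B) Φ)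

minterm : ∀ {n} → List ℕ → (ℕ → Bool) → Form n
minterm P a = ⋀ (map (λ x → if a x then atom x else neg (atom x)) P)

canon : ∀ {n} → Form n → (Subset n → List (Form n)) → Form n
canon {n} δ₀ Φ = δ₀ ∧ᶠ ⋀ (map (λ B → ∇ B (Φ B)) (coalitions n))

data InD {n : ℕ} (P : List ℕ) : ℕ → Form n → Set where
  d0   : (a : ℕ → Bool) → InD P zero (minterm P a)
  dsuc : ∀ {k} (a : ℕ → Bool) (Φ : Subset n → List (Form n)) →
         (∀ B → All (InD P k) (Φ B)) →
         InD P (suc k) (canon (minterm P a) Φ)

record Model (n : ℕ) : Set₁ where
  field
    S : Set
    R : Fin n → S → S → Set
    V : S → ℕ → Bool
open Model public

RB : ∀ {n} (M : Model n) → Subset n → S M → S M → Set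
RB M B s t = ∀ i → i ∈ B → R M i s t

_,_⊨_ : ∀ {n} (M : Model n) → S M → Form n → Set
M , s ⊨ atom x  = V M s x ≡ true
M , s ⊨ top     = ⊤
M , s ⊨ bot     = ⊥
M , s ⊨ neg φ   = ¬ (M , s ⊨ φ)
M , s ⊨ (φ ∧ᶠ ψ) = (M , s ⊨ φ) × (M , s ⊨ ψ)
M , s ⊨ (φ ∨ᶠ ψ) = (M , s ⊨ φ) ⊎ (M , s ⊨ ψ)
M , s ⊨ D B φ   = ∀ t → RB M B s t → M , t ⊨ φ

Transitive Euclidean Serial Reflexive : ∀ {n} → Model n → Set
Transitive M = ∀ i x y z → R M i x y → R M i y z → R M i x z
Euclidean  M = ∀ i x y z → R M i x y → R M i x z → R M i y z
Serial     M = ∀ i x → Σ (S M) λ y → R M i x y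
Reflexive  M = ∀ i x → R M i x x

data Logic : Set where
  K45nD KD45nD S5nD : Logic

IsModel : ∀ {n} → Logic → Model n → Set
IsModel K45nD  M = Transitive M × Euclidean M
IsModel KD45nD M = Serial M × Transitive M × Euclidean M
IsModel S5nD   M = Reflexive M × Transitive M × Euclidean M

InDL : ∀ {n} → Logic → List ℕ → ℕ → Form n → Set₁
InDL {n} L P k δ = InD P k δ × Σ (Model n) λ M → Σ (S M) λ s → IsModel L M × M , s ⊨ δ

forgetSyn : ∀ {n} → ℕ → Form n → Form n
forgetSyn p (atom x) with x ≟ p
... | yes _ = top
... | no  _ = atom x
forgetSyn p top = top
forgetSyn p bot = bot
forgetSyn p (neg (atom x)) with x ≟ p
... | yes _ = top
... | no  _ = neg (atom x)
forgetSyn p (neg φ) = neg (forgetSyn p φ)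
forgetSyn p (φ ∧ᶠ ψ) = forgetSyn p φ ∧ᶠ forgetSyn p ψ
forgetSyn p (φ ∨ᶠ ψ) = forgetSyn p φ ∨ᶠ forgetSyn p ψ
forgetSyn p (D B φ) = D B (forgetSyn p φ)

CollBisim : ∀ {n} → ℕ → (M : Model n) → S M → (M' : Model n) → S M' → Set₁
CollBisim {n} p M s M' s' =
  Σ (S M → S M' → Set) λ ρ →
    ρ s s' ×
    (∀ u u' → ρ u u' → ∀ x → x ≢ p → V M u x ≡ V M' u' x) ×
    (∀ u u' → ρ u u' → ∀ (C : Subset n) → Nonempty C →
       ∀ t → RB M C u t → Σ (S M') λ t' → RB M' C u' t' × ρ t t') ×
    (∀ u u' → ρ u u' → ∀ (C : Subset n) → Nonempty C →
       ∀ t' → RB M' C u' t' → Σ (S M) λ t → RB M C u t × ρ t t')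

Occurs : ∀ {n} → ℕ → Form n → Set
Occurs x (atom y) = x ≡ y
Occurs x top = ⊥
Occurs x bot = ⊥
Occurs x (neg φ) = Occurs x φ
Occurs x (φ ∧ᶠ ψ) = Occurs x φ ⊎ Occurs x ψ
Occurs x (φ ∨ᶠ ψ) = Occurs x φ ⊎ Occurs x ψ
Occurs x (D B φ) = Occurs x φ

IsForgetResult : ∀ {n} → Logic → ℕ → Form n → Form n → Set₁
IsForgetResult {n} L p φ ψ =
  (∀ x → Occurs x ψ → Occurs x φ × x ≢ p) ×
  (∀ (M : Model n) s (M' : Model n) s' → IsModel L M → M , s ⊨ φ →
     IsModel L M' → CollBisim p M s M' s' → M' , s' ⊨ ψ) ×
  (∀ (M' : Model n) s' → IsModel L M' → M' , s' ⊨ ψ →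
     Σ (Model n) λ M → Σ (S M) λ s → IsModel L M × M , s ⊨ φ × CollBisim p M s M' s')

{-# OPTIONS --safe #-}
-- M₀ is a chain c₀ c₁ c₂ … whose links alternate between agents 2 and 3, with a gadget {wx, wy}
-- attached at c₀; M₁ erases p and lets agent 2 also link wx and wy. For k = d + 2 the formula δ is
-- the depth-k characteristic formula χ of c_d in M₀. The new link lies at distance k from c_d and
-- joins worlds differing only in p, so c_d in M₁ is k-p-bisimilar to c_d in M₀ and satisfies δ^p.
-- Conversely, let (M, s) ⊨ δ be a K45-model fully p-bisimilar to (M₁, c_d). As q separates
-- consecutive chain worlds, χ lets us walk back along the chain to a copy U of c₀ with U ⊨ χ 2 c₀.
-- The bisimulation yields an agent-1 successor X of U copying wx and, along the new link, an
-- agent-{1,2} successor Y of X copying wy, at which χ 1 wx makes p true. By transitivity Y is an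
-- agent-1 successor of U, and χ 2 c₀ allows no such world.
module Submission where

open import Defs
open import Data.Nat using (ℕ; zero; suc; _+_; _≤_; _*_; z≤n; s≤s; _≟_)
open import Data.Nat.Properties using (≤-refl; ≤-reflexive; ≤-trans; ≤-pred; n≤1+n; m≤n⇒m≤1+n; n<1⇒n≡0)
open import Data.Bool using (Bool; true; false; if_then_else_)
open import Data.Bool.Properties using (not-¬; ¬-not)
import Data.Bool as Bool
open import Data.Fin using (Fin; zero; suc)
open import Data.Fin.Subset using (Subset; Nonempty; ⁅_⁆; _∪_)
open import Data.Fin.Subset.Properties using (nonempty?; _∈?_; x∈⁅x⁆; x∈⁅y⁆⇒x≡y; x∈p∪q⁻; p⊆p∪q; q⊆p∪q)
open import Data.Fin.Properties using (all?)
open import Data.Vec using ([]; _∷_)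
open import Data.List using (List; []; _∷_; map; filter)
open import Data.List.Properties using (map-∘)
open import Function using (_∘_)
open import Data.List.Membership.Propositional using (_∈_)
open import Data.List.Membership.Propositional.Properties using (∈-filter⁺; ∈-filter⁻; ∈-map⁺; ∈-++⁺ˡ; ∈-++⁺ʳ)
open import Data.List.Relation.Unary.Any using (here; there)
open import Data.List.Relation.Unary.All as All using (All; []; _∷_)
import Data.List.Relation.Unary.All.Properties as All
open import Data.Product using (Σ; _×_; _,_; proj₁; proj₂)
open import Data.Product.Properties using (≡-dec)
open import Data.Sum using (_⊎_; inj₁; inj₂; [_,_])
open import Data.Unit using (tt)
open import Data.Empty using (⊥-elim)
open import Relation.Nullary using (¬_; Dec; yes; no; does)
open import Relation.Nullary.Decidable using (_→-dec_; dec-true; dec-false; map′)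
open import Relation.Binary.Definitions using (DecidableEquality)
open import Relation.Binary.PropositionalEquality using (_≡_; _≢_; refl; sym; trans; subst; cong)

private
  variable
    n : ℕ

pattern 1st = here refl
pattern 2nd = there 1st
pattern 3rd = there 2nd
pattern 4th = there 3rd

literal : (ℕ → Bool) → ℕ → Form n
literal a x = if a x then atom x else neg (atom x)

⋀-not-atom : ∀ (φs : List (Form n)) x → ⋀ φs ≢ atom x
⋀-not-atom []      x ()
⋀-not-atom (_ ∷ _) x ()

module _ {M : Model n} {w : S M} {A : Set} where

  ⊨⋀-map⁺ : ∀ (f : A → Form n) xs → (∀ {x} → x ∈ xs → M , w ⊨ f x) → M , w ⊨ ⋀ (map f xs)
  ⊨⋀-map⁺ f []       _    = tt
  ⊨⋀-map⁺ f (x ∷ xs) sats = sats 1st , ⊨⋀-map⁺ f xs (sats ∘ there)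

  ⊨⋀-map²⁺ : ∀ (g : Form n → Form n) (f : A → Form n) xs → (∀ {x} → x ∈ xs → M , w ⊨ g (f x)) →
             M , w ⊨ ⋀ (map g (map f xs))
  ⊨⋀-map²⁺ g f xs sats = subst (λ φs → M , w ⊨ ⋀ φs) (map-∘ xs) (⊨⋀-map⁺ (g ∘ f) xs sats)

  ⊨⋀-map⁻ : ∀ (f : A → Form n) xs {x} → M , w ⊨ ⋀ (map f xs) → x ∈ xs → M , w ⊨ f x
  ⊨⋀-map⁻ f (_ ∷ xs) (sat , _)  1st        = sat
  ⊨⋀-map⁻ f (_ ∷ xs) (_ , sats) (there x∈) = ⊨⋀-map⁻ f xs sats x∈

  ⊨⋁-map⁺ : ∀ (f : A → Form n) xs {x} → x ∈ xs → M , w ⊨ f x → M , w ⊨ ⋁ (map f xs)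
  ⊨⋁-map⁺ f (_ ∷ xs) 1st        sat = inj₁ sat
  ⊨⋁-map⁺ f (_ ∷ xs) (there x∈) sat = inj₂ (⊨⋁-map⁺ f xs x∈ sat)

  ⊨⋁-map⁻ : ∀ (f : A → Form n) xs → M , w ⊨ ⋁ (map f xs) → Σ A λ x → x ∈ xs × M , w ⊨ f x
  ⊨⋁-map⁻ f (x ∷ xs) (inj₁ sat) = x , 1st , sat
  ⊨⋁-map⁻ f (x ∷ xs) (inj₂ sat) with ⊨⋁-map⁻ f xs sat
  ... | y , y∈ , sat' = y , there y∈ , sat'

module _ {M : Model n} {w : S M} where

  ⊨literal : ∀ x → M , w ⊨ literal (V M w) x
  ⊨literal x with V M w x in Vx
  ... | true  = Vx
  ... | false = not-¬ Vx

  literal⇒V : ∀ a x → M , w ⊨ literal a x → V M w x ≡ a x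
  literal⇒V a x with a x
  ... | true  = λ Vx → Vx
  ... | false = ¬-not

  ⊨minterm : ∀ P → M , w ⊨ minterm P (V M w)
  ⊨minterm P = ⊨⋀-map⁺ (literal (V M w)) P λ {x} _ → ⊨literal x

  minterm⇒V : ∀ {P a x} → M , w ⊨ minterm P a → x ∈ P → V M w x ≡ a x
  minterm⇒V {P} {a} sat x∈P = literal⇒V a _ (⊨⋀-map⁻ (literal a) P sat x∈P)

forgetSyn-neg : ∀ p (φ : Form n) → (∀ x → φ ≢ atom x) → forgetSyn p (neg φ) ≡ neg (forgetSyn p φ)
forgetSyn-neg p (atom x) not-atom = ⊥-elim (not-atom x refl)
forgetSyn-neg p top      _ = refl
forgetSyn-neg p bot      _ = refl
forgetSyn-neg p (neg φ)  _ = refl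
forgetSyn-neg p (φ ∧ᶠ ψ) _ = refl
forgetSyn-neg p (φ ∨ᶠ ψ) _ = refl
forgetSyn-neg p (D B φ)  _ = refl

module _ (p : ℕ) {M : Model n} {w : S M} where

  ⊨forget-⋀-map⁺ : ∀ {A : Set} (f : A → Form n) xs → (∀ {x} → x ∈ xs → M , w ⊨ forgetSyn p (f x)) →
                   M , w ⊨ forgetSyn p (⋀ (map f xs))
  ⊨forget-⋀-map⁺ f []       _    = tt
  ⊨forget-⋀-map⁺ f (x ∷ xs) sats = sats 1st , ⊨forget-⋀-map⁺ f xs (sats ∘ there)

  ⊨forget-⋀-map²⁺ : ∀ {A : Set} (g : Form n → Form n) (f : A → Form n) xs →
                    (∀ {x} → x ∈ xs → M , w ⊨ forgetSyn p (g (f x))) →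
                    M , w ⊨ forgetSyn p (⋀ (map g (map f xs)))
  ⊨forget-⋀-map²⁺ g f xs sats =
    subst (λ φs → M , w ⊨ forgetSyn p (⋀ φs)) (map-∘ xs) (⊨forget-⋀-map⁺ (g ∘ f) xs sats)

  ⊨forget-⋁-map⁺ : ∀ {A : Set} (f : A → Form n) xs {x} → x ∈ xs → M , w ⊨ forgetSyn p (f x) →
                   M , w ⊨ forgetSyn p (⋁ (map f xs))
  ⊨forget-⋁-map⁺ f (_ ∷ xs) 1st        sat = inj₁ sat
  ⊨forget-⋁-map⁺ f (_ ∷ xs) (there x∈) sat = inj₂ (⊨forget-⋁-map⁺ f xs x∈ sat)

  ⊨forget-literal : ∀ a x → (x ≢ p → V M w x ≡ a x) → M , w ⊨ forgetSyn p (literal a x)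
  ⊨forget-literal a x agree with a x
  ... | true  with x ≟ p
  ...   | yes _   = tt
  ...   | no x≢p = agree x≢p
  ⊨forget-literal a x agree | false with x ≟ p
  ...   | yes _   = tt
  ...   | no x≢p = not-¬ (agree x≢p)

  ⊨forget-minterm : ∀ P a → (∀ {x} → x ∈ P → x ≢ p → V M w x ≡ a x) →
                    M , w ⊨ forgetSyn p (minterm P a)
  ⊨forget-minterm P a agree = ⊨forget-⋀-map⁺ (literal a) P λ x∈P → ⊨forget-literal a _ (agree x∈P)

∈-allSubsets : (B : Subset n) → B ∈ allSubsets n
∈-allSubsets []                = 1st
∈-allSubsets {suc n} (true ∷ B)  = ∈-++⁺ˡ (∈-map⁺ (true ∷_) (∈-allSubsets B))
∈-allSubsets {suc n} (false ∷ B) = ∈-++⁺ʳ (map (true ∷_) (allSubsets n)) (∈-map⁺ (false ∷_) (∈-allSubsets B))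

∈-coalitions⁺ : {B : Subset n} → Nonempty B → B ∈ coalitions n
∈-coalitions⁺ {B = B} ne = ∈-filter⁺ nonempty? (∈-allSubsets B) ne

∈-coalitions⁻ : {B : Subset n} → B ∈ coalitions n → Nonempty B
∈-coalitions⁻ {n} B∈ = proj₂ (∈-filter⁻ nonempty? {xs = allSubsets n} B∈)

module _ (M : Model n) {u t : S M} where

  RB-⁅⁆⁺ : ∀ i → R M i u t → RB M ⁅ i ⁆ u t
  RB-⁅⁆⁺ i r j j∈ = subst (λ k → R M k u t) (sym (x∈⁅y⁆⇒x≡y i j∈)) r

  RB-⁅⁆⁻ : ∀ i → RB M ⁅ i ⁆ u t → R M i u t
  RB-⁅⁆⁻ i rb = rb i (x∈⁅x⁆ i)

  RB-∪⁺ : ∀ B B' → RB M B u t → RB M B' u t → RB M (B ∪ B') u t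
  RB-∪⁺ B B' rb rb' i i∈ = [ rb i , rb' i ] (x∈p∪q⁻ B B' i∈)

  RB-∪⁻ˡ : ∀ B B' → RB M (B ∪ B') u t → RB M B u t
  RB-∪⁻ˡ B B' rb i i∈ = rb i (p⊆p∪q B' i∈)

  RB-∪⁻ʳ : ∀ B B' → RB M (B ∪ B') u t → RB M B' u t
  RB-∪⁻ʳ B B' rb i i∈ = rb i (q⊆p∪q B B' i∈)

⁅⁆-nonempty : (i : Fin n) → Nonempty ⁅ i ⁆
⁅⁆-nonempty i = i , x∈⁅x⁆ i

kernel : {K : Set} (W : Set) → (Fin n → W → K) → (W → ℕ → Bool) → Model n
kernel W f val = record { S = W ; R = λ i w v → f i w ≡ f i v ; V = val }

kernel-S5 : {K : Set} (W : Set) (f : Fin n → W → K) (val : W → ℕ → Bool) → IsModel S5nD (kernel W f val)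
kernel-S5 _ _ _ = (λ _ _ → refl) , (λ _ _ _ _ → trans) , (λ _ _ _ _ e e' → trans (sym e) e')

S5⇒IsModel : {M : Model n} → IsModel S5nD M → ∀ L → IsModel L M
S5⇒IsModel (_ , K45)         K45nD  = K45
S5⇒IsModel (reflexive , K45) KD45nD = (λ i x → x , reflexive i x) , K45
S5⇒IsModel S5                S5nD   = S5

IsModel⇒K45 : {M : Model n} → ∀ L → IsModel L M → IsModel K45nD M
IsModel⇒K45 K45nD  K45       = K45
IsModel⇒K45 KD45nD (_ , K45) = K45
IsModel⇒K45 S5nD   (_ , K45) = K45

K45Preimage : ℕ → Form n → (M' : Model n) → S M' → Set₁
K45Preimage {n} p φ M' s' =
  Σ (Model n) λ M → Σ (S M) λ s → IsModel K45nD M × M , s ⊨ φ × CollBisim p M s M' s'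

¬IsForgetResult : ∀ L {p} {φ ψ : Form n} {M' : Model n} {s'} →
  IsModel S5nD M' → M' , s' ⊨ ψ → ¬ K45Preimage p φ M' s' → ¬ IsForgetResult L p φ ψ
¬IsForgetResult L {M' = M'} {s'} S5 sat noPreimage (_ , _ , complete) =
  let M , s , isModel , satφ , bisim = complete M' s' (S5⇒IsModel S5 L) sat
  in  noPreimage (M , s , IsModel⇒K45 L isModel , satφ , bisim)

-- χ j w is the formula of D^P_j describing w up to modal depth j; the finite candidate lists
-- `neighbours` make each ∇_B in it a finite formula.
module Characteristic (M : Model n) (P : List ℕ)
    (neighbours : S M → List (S M))
    (neighbours-complete : ∀ {i w v} → R M i w v → v ∈ neighbours w)
    (R? : ∀ i w v → Dec (R M i w v)) where

  RB? : ∀ B w v → Dec (RB M B w v)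
  RB? B w v = all? λ i → i ∈? B →-dec R? i w v

  successors : Subset n → S M → List (S M)
  successors B w = filter (RB? B w) (neighbours w)

  ∈-successors⁺ : ∀ {B w v} → Nonempty B → RB M B w v → v ∈ successors B w
  ∈-successors⁺ {B} {w} (i , i∈) rb = ∈-filter⁺ (RB? B w) (neighbours-complete (rb i i∈)) rb

  ∈-successors⁻ : ∀ {B w v} → v ∈ successors B w → RB M B w v
  ∈-successors⁻ {B} {w} v∈ = proj₂ (∈-filter⁻ (RB? B w) {xs = neighbours w} v∈)

  χ : ℕ → S M → Form n
  χ zero    w = minterm P (V M w)
  χ (suc j) w = canon (minterm P (V M w)) λ B → map (χ j) (successors B w)

  ∇χ : ℕ → S M → Subset n → Form n
  ∇χ j w B = ∇ B (map (χ j) (successors B w))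

  χ-not-atom : ∀ j w x → χ j w ≢ atom x
  χ-not-atom zero    w x = ⋀-not-atom (map (literal (V M w)) P) x
  χ-not-atom (suc j) w x ()

  χ∈D : ∀ j w → InD P j (χ j w)
  χ∈D zero    w = d0 (V M w)
  χ∈D (suc j) w = dsuc (V M w) (λ B → map (χ j) (successors B w))
                       λ B → All.map⁺ (All.tabulate {xs = successors B w} λ {v} _ → χ∈D j v)

  ⊨χ : ∀ j w → M , w ⊨ χ j w
  ⊨χ zero    w = ⊨minterm P
  ⊨χ (suc j) w = ⊨minterm P , ⊨⋀-map⁺ (∇χ j w) (coalitions n)
                                  λ B∈ → ⊨∇ (∈-coalitions⁻ B∈)
    where
    ⊨∇ : ∀ {B} → Nonempty B → M , w ⊨ ∇χ j w B
    ⊨∇ {B} ne =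
        (λ t rb → ⊨⋁-map⁺ (χ j) (successors B w) (∈-successors⁺ ne rb) (⊨χ j t))
      , ⊨⋀-map²⁺ (Dhat B) (χ j) (successors B w) λ {v} v∈ ¬sat → ¬sat v (∈-successors⁻ v∈) (⊨χ j v)

  module _ {M' : Model n} {u : S M'} where

    χ⇒V : ∀ {j w x} → M' , u ⊨ χ j w → x ∈ P → V M' u x ≡ V M w x
    χ⇒V {zero}  sat       = minterm⇒V sat
    χ⇒V {suc j} (sat , _) = minterm⇒V sat

    χ⇒∇ : ∀ {j w B} → M' , u ⊨ χ (suc j) w → Nonempty B → M' , u ⊨ ∇χ j w B
    χ⇒∇ {j} {w} (_ , sat) ne = ⊨⋀-map⁻ (∇χ j w) (coalitions n) sat (∈-coalitions⁺ ne)

    χ-successor : ∀ {j w B u'} → M' , u ⊨ χ (suc j) w → Nonempty B → RB M' B u u' →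
                  Σ (S M) λ v → RB M B w v × M' , u' ⊨ χ j v
    χ-successor {j} {w} {B} sat ne rb
      with ⊨⋁-map⁻ (χ j) (successors B w) (proj₁ (χ⇒∇ {j} {w} sat ne) _ rb)
    ... | v , v∈ , sat' = v , ∈-successors⁻ v∈ , sat'

    χ-D̂ : ∀ {j w B v} → M' , u ⊨ χ (suc j) w → Nonempty B → RB M B w v → M' , u ⊨ Dhat B (χ j v)
    χ-D̂ {j} {w} {B} sat ne rb =
      ⊨⋀-map⁻ (Dhat B) (map (χ j) (successors B w)) (proj₂ (χ⇒∇ {j} {w} sat ne))
              (∈-map⁺ (χ j) (∈-successors⁺ ne rb))

  module Forgetting (p : ℕ) {M' : Model n} where

    BisimUpTo : ℕ → S M' → S M → Set
    BisimUpTo zero    w' w = ∀ {x} → x ∈ P → x ≢ p → V M' w' x ≡ V M w x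
    BisimUpTo (suc j) w' w =
      BisimUpTo zero w' w ×
      (∀ B → Nonempty B → ∀ t' → RB M' B w' t' → Σ (S M) λ t → RB M B w t × BisimUpTo j t' t) ×
      (∀ B → Nonempty B → ∀ t → RB M B w t → Σ (S M') λ t' → RB M' B w' t' × BisimUpTo j t' t)

    ⊨forget-χ : ∀ j {w' w} → BisimUpTo j w' w → M' , w' ⊨ forgetSyn p (χ j w)
    ⊨forget-χ zero    {w = w} agree = ⊨forget-minterm p P (V M w) agree
    ⊨forget-χ (suc j) {w'} {w} (agree , zig , zag) =
      ⊨forget-minterm p P (V M w) agree
      , ⊨forget-⋀-map⁺ p (∇χ j w) (coalitions n) λ B∈ → ⊨forget-∇ (∈-coalitions⁻ B∈)
      where
      ⊨forget-D̂ : ∀ {B v} → Nonempty B → RB M B w v → M' , w' ⊨ forgetSyn p (Dhat B (χ j v))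
      ⊨forget-D̂ {B} {v} ne rb rewrite forgetSyn-neg p (χ j v) (χ-not-atom j v) = λ ¬sat →
        let t' , rb' , bisim = zag B ne v rb in ¬sat t' rb' (⊨forget-χ j bisim)

      ⊨forget-∇ : ∀ {B} → Nonempty B → M' , w' ⊨ forgetSyn p (∇χ j w B)
      ⊨forget-∇ {B} ne =
          (λ t' rb' → let t , rb , bisim = zig B ne t' rb' in
             ⊨forget-⋁-map⁺ p (χ j) (successors B w) (∈-successors⁺ ne rb) (⊨forget-χ j bisim))
        , ⊨forget-⋀-map²⁺ p (Dhat B) (χ j) (successors B w) λ v∈ → ⊨forget-D̂ ne (∈-successors⁻ v∈)

data Role : Set where
  a₁ a₂ a₃ : Role

role : Fin n → Role
role zero                = a₁
role (suc zero)          = a₂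
role (suc (suc zero))    = a₃
role (suc (suc (suc _))) = a₁

-- pt (m , b) is the chain world c_{2m+b}.
data W : Set where
  pt    : ℕ × Bool → W
  wx wy : W

_≟ʷ_ : DecidableEquality W
pt c ≟ʷ pt c' = map′ (cong pt) (λ { refl → refl }) (≡-dec _≟_ Bool._≟_ c c')
pt _ ≟ʷ wx    = no λ ()
pt _ ≟ʷ wy    = no λ ()
wx   ≟ʷ pt _  = no λ ()
wx   ≟ʷ wx    = yes refl
wx   ≟ʷ wy    = no λ ()
wy   ≟ʷ pt _  = no λ ()
wy   ≟ʷ wx    = no λ ()
wy   ≟ʷ wy    = yes refl

c₀ : W
c₀ = pt (0 , false)

qv : W → Bool
qv (pt (_ , b)) = b
qv wx           = true
qv wy           = true

pv : W → Bool
pv wy = false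
pv _  = true

-- cls₀ a w represents the a-class of w in M₀: agent 2 links c_{2m} with c_{2m+1}, agent 3 links
-- c_{2m+1} with c_{2m+2} and c₀ with wx, agent 1 links c₀, wx and wy; all other classes are singletons.
cls₀ : Role → W → W
cls₀ a₁ (pt (m , true))      = pt (m , true)
cls₀ a₁ (pt (zero , false))  = wx
cls₀ a₁ (pt (suc m , false)) = pt (suc m , false)
cls₀ a₁ wx                   = wx
cls₀ a₁ wy                   = wx
cls₀ a₂ (pt (m , _))         = pt (m , false)
cls₀ a₂ wx                   = wx
cls₀ a₂ wy                   = wy
cls₀ a₃ (pt (m , true))      = pt (m , true)
cls₀ a₃ (pt (zero , false))  = wx
cls₀ a₃ (pt (suc m , false)) = pt (m , true)
cls₀ a₃ wx                   = wx
cls₀ a₃ wy                   = wy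

merge : Role → W → W
merge a₂ wy = wx
merge _  r  = r

cls₁ : Role → W → W
cls₁ a w = merge a (cls₀ a w)

-- The a-class represented by r (junk when r represents no a-class).
members : Role → W → List W
members a₁ (pt c)       = pt c ∷ []
members a₁ wx           = c₀ ∷ wx ∷ wy ∷ []
members a₁ wy           = []
members a₂ (pt (m , _)) = pt (m , false) ∷ pt (m , true) ∷ []
members a₂ wx           = wx ∷ []
members a₂ wy           = wy ∷ []
members a₃ (pt (m , _)) = pt (m , true) ∷ pt (suc m , false) ∷ []
members a₃ wx           = c₀ ∷ wx ∷ []
members a₃ wy           = wy ∷ []

∈-members : ∀ a w → w ∈ members a (cls₀ a w)
∈-members a₁ (pt (m , true))      = 1st
∈-members a₁ (pt (zero , false))  = 1st
∈-members a₁ (pt (suc m , false)) = 1st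
∈-members a₁ wx                   = 2nd
∈-members a₁ wy                   = 3rd
∈-members a₂ (pt (m , false))     = 1st
∈-members a₂ (pt (m , true))      = 2nd
∈-members a₂ wx                   = 1st
∈-members a₂ wy                   = 1st
∈-members a₃ (pt (m , true))      = 1st
∈-members a₃ (pt (zero , false))  = 1st
∈-members a₃ (pt (suc m , false)) = 2nd
∈-members a₃ wx                   = 2nd
∈-members a₃ wy                   = 1st

neighbours : W → List W
neighbours (pt (m , true))      = pt (m , false) ∷ pt (m , true) ∷ pt (suc m , false) ∷ []
neighbours (pt (zero , false))  = c₀ ∷ pt (0 , true) ∷ wx ∷ wy ∷ []
neighbours (pt (suc m , false)) = pt (m , true) ∷ pt (suc m , false) ∷ pt (suc m , true) ∷ []
neighbours wx                   = c₀ ∷ wx ∷ wy ∷ []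
neighbours wy                   = c₀ ∷ wx ∷ wy ∷ []

members⊆neighbours : ∀ a w → All (_∈ neighbours w) (members a (cls₀ a w))
members⊆neighbours a₁ (pt (m , true))      = 2nd ∷ []
members⊆neighbours a₁ (pt (zero , false))  = 1st ∷ 3rd ∷ 4th ∷ []
members⊆neighbours a₁ (pt (suc m , false)) = 2nd ∷ []
members⊆neighbours a₁ wx                   = 1st ∷ 2nd ∷ 3rd ∷ []
members⊆neighbours a₁ wy                   = 1st ∷ 2nd ∷ 3rd ∷ []
members⊆neighbours a₂ (pt (m , true))      = 1st ∷ 2nd ∷ []
members⊆neighbours a₂ (pt (zero , false))  = 1st ∷ 2nd ∷ []
members⊆neighbours a₂ (pt (suc m , false)) = 2nd ∷ 3rd ∷ []
members⊆neighbours a₂ wx                   = 2nd ∷ []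
members⊆neighbours a₂ wy                   = 3rd ∷ []
members⊆neighbours a₃ (pt (m , true))      = 2nd ∷ 3rd ∷ []
members⊆neighbours a₃ (pt (zero , false))  = 1st ∷ 3rd ∷ []
members⊆neighbours a₃ (pt (suc m , false)) = 1st ∷ 2nd ∷ []
members⊆neighbours a₃ wx                   = 1st ∷ 2nd ∷ []
members⊆neighbours a₃ wy                   = 3rd ∷ []

neighbours-complete : ∀ a {w v} → cls₀ a w ≡ cls₀ a v → v ∈ neighbours w
neighbours-complete a {w} {v} same =
  All.lookup (members⊆neighbours a w) (subst (λ r → v ∈ members a r) (sym same) (∈-members a v))

q-in-a₁-class-of-c₀ : ∀ v → cls₀ a₁ c₀ ≡ cls₀ a₁ v → qv v ≡ true → v ≡ wx ⊎ v ≡ wy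
q-in-a₁-class-of-c₀ (pt (m , true))      () _
q-in-a₁-class-of-c₀ (pt (zero , false))  _  ()
q-in-a₁-class-of-c₀ (pt (suc m , false)) () _
q-in-a₁-class-of-c₀ wx                   _  _ = inj₁ refl
q-in-a₁-class-of-c₀ wy                   _  _ = inj₂ refl

a₂-class-of-wx : ∀ v → cls₀ a₂ wx ≡ cls₀ a₂ v → v ≡ wx
a₂-class-of-wx (pt _) ()
a₂-class-of-wx wx     _ = refl
a₂-class-of-wx wy     ()

a₃-class-of-wy : ∀ v → cls₀ a₃ wy ≡ cls₀ a₃ v → v ≡ wy
a₃-class-of-wy (pt (m , true))      ()
a₃-class-of-wy (pt (zero , false))  ()
a₃-class-of-wy (pt (suc m , false)) ()
a₃-class-of-wy wx                   ()
a₃-class-of-wy wy                   _ = refl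

-- One more than the distance from w to the gadget {wx, wy}.
depth : W → ℕ
depth (pt (m , false)) = 2 + m * 2
depth (pt (m , true))  = 3 + m * 2
depth wx               = 1
depth wy               = 1

depth-neighbours : ∀ w → All (λ v → depth w ≤ suc (depth v)) (neighbours w)
depth-neighbours (pt (m , true))      = ≤-refl ∷ n≤1+n _ ∷ m≤n⇒m≤1+n (n≤1+n _) ∷ []
depth-neighbours (pt (zero , false))  = 2≤2+ ∷ 2≤2+ ∷ 2≤2+ ∷ 2≤2+ ∷ []
  where
  2≤2+ : ∀ {k} → 2 ≤ 2 + k
  2≤2+ = s≤s (s≤s z≤n)
depth-neighbours (pt (suc m , false)) = ≤-refl ∷ n≤1+n _ ∷ m≤n⇒m≤1+n (n≤1+n _) ∷ []
depth-neighbours wx                   = s≤s z≤n ∷ s≤s z≤n ∷ s≤s z≤n ∷ []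
depth-neighbours wy                   = s≤s z≤n ∷ s≤s z≤n ∷ s≤s z≤n ∷ []

depth-step : ∀ a {w v} → cls₀ a w ≡ cls₀ a v → depth w ≤ suc (depth v)
depth-step a {w} same = All.lookup (depth-neighbours w) (neighbours-complete a same)

-- The only links M₁ adds join the two gadget worlds (the worlds of depth 1), which agree on q.
unmerge : ∀ w v → (∀ a → cls₁ a w ≡ cls₁ a v → cls₀ a w ≡ cls₀ a v) ⊎ (depth w ≡ 1 × qv v ≡ qv w)
unmerge wx     wy     = inj₂ (refl , refl)
unmerge wy     wx     = inj₂ (refl , refl)
unmerge (pt _) (pt _) = inj₁ λ { a₁ e → e ; a₂ e → e ; a₃ e → e }
unmerge (pt _) wx     = inj₁ λ { a₁ e → e ; a₂ () ; a₃ e → e }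
unmerge (pt _) wy     = inj₁ λ { a₁ e → e ; a₂ () ; a₃ e → e }
unmerge wx     (pt _) = inj₁ λ { a₁ e → e ; a₂ () ; a₃ e → e }
unmerge wy     (pt _) = inj₁ λ { a₁ e → e ; a₂ () ; a₃ e → e }
unmerge wx     wx     = inj₁ λ { a₁ e → e ; a₂ e → refl ; a₃ e → e }
unmerge wy     wy     = inj₁ λ { a₁ e → e ; a₂ e → refl ; a₃ e → e }

next : ℕ × Bool → ℕ × Bool
next (m , false) = m , true
next (m , true)  = suc m , false

chain : ℕ → ℕ × Bool
chain zero    = 0 , false
chain (suc d) = next (chain d)

depth-chain : ∀ d → depth (pt (chain d)) ≡ 2 + d
depth-chain zero    = refl
depth-chain (suc d) = trans (depth-next (chain d)) (cong suc (depth-chain d))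
  where
  depth-next : ∀ c → depth (pt (next c)) ≡ suc (depth (pt c))
  depth-next (m , false) = refl
  depth-next (m , true)  = refl

module Counterexample (n' p q : ℕ) (p≢q : p ≢ q) where

  N : ℕ
  N = 3 + n'

  val₀ val₁ : W → ℕ → Bool
  val₀ w x = if does (x ≟ p) then pv w else qv w
  val₁ w x = if does (x ≟ p) then false else qv w

  M₀ M₁ : Model N
  M₀ = kernel W (λ i → cls₀ (role i)) val₀
  M₁ = kernel W (λ i → cls₁ (role i)) val₁

  M₀-S5 : IsModel S5nD M₀
  M₀-S5 = kernel-S5 W (λ i → cls₀ (role i)) val₀

  M₁-S5 : IsModel S5nD M₁
  M₁-S5 = kernel-S5 W (λ i → cls₁ (role i)) val₁

  val₀-p : ∀ w → val₀ w p ≡ pv w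
  val₀-p w rewrite dec-true (p ≟ p) refl = refl

  val₀-off-p : ∀ w {x} → x ≢ p → val₀ w x ≡ qv w
  val₀-off-p w {x} x≢p rewrite dec-false (x ≟ p) x≢p = refl

  val₁-off-p : ∀ w {x} → x ≢ p → val₁ w x ≡ qv w
  val₁-off-p w {x} x≢p rewrite dec-false (x ≟ p) x≢p = refl

  q≢p : q ≢ p
  q≢p = p≢q ∘ sym

  P : List ℕ
  P = p ∷ q ∷ []

  open Characteristic M₀ P neighbours (λ {i} → neighbours-complete (role i))
                      (λ i w v → cls₀ (role i) w ≟ʷ cls₀ (role i) v) public
  open Forgetting p {M₁} public

  bisimUpTo-0 : ∀ w' w → qv w' ≡ qv w → BisimUpTo 0 w' w
  bisimUpTo-0 w' w same-q _ x≢p = trans (val₁-off-p w' x≢p) (trans same-q (sym (val₀-off-p w x≢p)))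

  M₁≈M₀ : ∀ j w → j ≤ depth w → BisimUpTo j w w
  M₁≈M₀ zero    w _       = bisimUpTo-0 w w refl
  M₁≈M₀ (suc j) w j<depth = bisimUpTo-0 w w refl , zig , zag
    where
    below : ∀ {i t} → R M₀ i w t → j ≤ depth t
    below {i} rb = ≤-pred (≤-trans j<depth (depth-step (role i) rb))

    zig : ∀ B → Nonempty B → ∀ t' → RB M₁ B w t' → Σ W λ t → RB M₀ B w t × BisimUpTo j t' t
    zig B (i , i∈) t' rb' with unmerge w t'
    ... | inj₁ unmerged = t' , rb , M₁≈M₀ j t' (below (rb i i∈))
      where
      rb : RB M₀ B w t'
      rb k k∈ = unmerged (role k) (rb' k k∈)
    ... | inj₂ (depth≡1 , same-q) rewrite n<1⇒n≡0 (subst (suc j ≤_) depth≡1 j<depth) =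
      w , (λ _ _ → refl) , bisimUpTo-0 t' w same-q

    zag : ∀ B → Nonempty B → ∀ t → RB M₀ B w t → Σ W λ t' → RB M₁ B w t' × BisimUpTo j t' t
    zag B (i , i∈) t rb = t , (λ k k∈ → cong (merge (role k)) (rb k k∈)) , M₁≈M₀ j t (below (rb i i∈))

  step-back : ∀ c → Σ (Fin N) λ i →
              R M₁ i (pt (next c)) (pt c) × (∀ v → R M₀ i (pt (next c)) v → qv v ≡ qv (pt c) → v ≡ pt c)
  step-back (m , false) = suc zero , refl , back
    where
    back : ∀ v → pt (m , false) ≡ cls₀ a₂ v → qv v ≡ false → v ≡ pt (m , false)
    back (pt (_ , false)) refl _  = refl
    back (pt (_ , true))  _    ()
    back wx               ()   _
    back wy               ()   _
  step-back (m , true) = suc (suc zero) , refl , back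
    where
    back : ∀ v → pt (m , true) ≡ cls₀ a₃ v → qv v ≡ true → v ≡ pt (m , true)
    back (pt (_ , true))      refl _  = refl
    back (pt (zero , false))  ()   _
    back (pt (suc _ , false)) _    ()
    back wx                   ()   _
    back wy                   ()   _

  i₁ i₂ i₃ : Fin N
  i₁ = zero
  i₂ = suc zero
  i₃ = suc (suc zero)

  A₁₂-nonempty : Nonempty (⁅ i₁ ⁆ ∪ ⁅ i₂ ⁆)
  A₁₂-nonempty = i₁ , p⊆p∪q ⁅ i₂ ⁆ (x∈⁅x⁆ i₁)

  q-χ : ∀ {M : Model N} {u} j v → M , u ⊨ χ j v → V M u q ≡ qv v
  q-χ j v sat = trans (χ⇒V {j = j} {v} sat 2nd) (val₀-off-p v q≢p)

  p-χ : ∀ {M : Model N} {u} j v → M , u ⊨ χ j v → V M u p ≡ pv v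
  p-χ j v sat = trans (χ⇒V {j = j} {v} sat 1st) (val₀-p v)

  module Refutation (M : Model N) (M-trans : Transitive M) (ρ : S M → W → Set)
      (agree : ∀ u u' → ρ u u' → ∀ x → x ≢ p → V M u x ≡ V M₁ u' x)
      (zig : ∀ u u' → ρ u u' → ∀ (C : Subset N) → Nonempty C →
               ∀ t → RB M C u t → Σ W λ t' → RB M₁ C u' t' × ρ t t')
      (zag : ∀ u u' → ρ u u' → ∀ (C : Subset N) → Nonempty C →
               ∀ t' → RB M₁ C u' t' → Σ (S M) λ t → RB M C u t × ρ t t') where

    q-clash : ∀ {u u'} j v → M , u ⊨ χ j v → ρ u u' → qv v ≡ qv u'
    q-clash {u' = u'} j v sat r = trans (sym (q-χ j v sat)) (trans (agree _ _ r q q≢p) (val₁-off-p u' q≢p))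

    descend : ∀ {U u' B} j w t' → ρ U u' → M , U ⊨ χ (suc j) w → Nonempty B → RB M₁ B u' t' →
              Σ (S M) λ U' → Σ W λ v → RB M B U U' × ρ U' t' × RB M₀ B w v × M , U' ⊨ χ j v
    descend j w t' r sat ne rb' with zag _ _ r _ ne t' rb'
    ... | U' , rb , r' with χ-successor {j = j} {w} sat ne rb
    ... | v , rb₀ , sat' = U' , v , rb , r' , rb₀ , sat'

    ¬χ₁wy-at-wx : ∀ {X} → ρ X wx → ¬ M , X ⊨ χ 1 wy
    ¬χ₁wy-at-wx r sat with descend 0 wy c₀ r sat (⁅⁆-nonempty i₃) (RB-⁅⁆⁺ M₁ i₃ refl)
    ... | _ , v , _ , r' , rb₀ , sat₀ with a₃-class-of-wy v (RB-⁅⁆⁻ M₀ i₃ rb₀)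
    ... | refl with q-clash 0 wy sat₀ r'
    ... | ()

    ¬χ₁wx-at-wy : ∀ {Y} → ρ Y wy → ¬ M , Y ⊨ χ 1 wx
    ¬χ₁wx-at-wy {Y} r sat =
      χ-D̂ {j = 0} {wx} {v = c₀} sat (⁅⁆-nonempty i₃) (RB-⁅⁆⁺ M₀ i₃ refl) no-copy-of-c₀
      where
      no-copy-of-c₀ : ∀ t → RB M ⁅ i₃ ⁆ Y t → ¬ M , t ⊨ χ 0 c₀
      no-copy-of-c₀ t rb sat₀ with zig _ _ r _ (⁅⁆-nonempty i₃) t rb
      ... | t' , rb' , r' with a₃-class-of-wy t' (RB-⁅⁆⁻ M₁ i₃ rb')
      ... | refl with q-clash 0 c₀ sat₀ r'
      ... | ()

    wx-reaches-p-copy-of-wy : ∀ {X} → ρ X wx → M , X ⊨ χ 1 wx →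
                              Σ (S M) λ Y → R M i₁ X Y × ρ Y wy × V M Y p ≡ true
    wx-reaches-p-copy-of-wy r sat
      with descend 0 wx wy r sat A₁₂-nonempty
                   (RB-∪⁺ M₁ ⁅ i₁ ⁆ ⁅ i₂ ⁆ (RB-⁅⁆⁺ M₁ i₁ refl) (RB-⁅⁆⁺ M₁ i₂ refl))
    ... | Y , v , rb , r' , rb₀ , sat₀
      with a₂-class-of-wx v (RB-⁅⁆⁻ M₀ i₂ (RB-∪⁻ʳ M₀ ⁅ i₁ ⁆ ⁅ i₂ ⁆ rb₀))
    ... | refl = Y , RB-⁅⁆⁻ M i₁ (RB-∪⁻ˡ M ⁅ i₁ ⁆ ⁅ i₂ ⁆ rb) , r' , p-χ 0 wx sat₀

    ¬p-copy-of-wy-near-c₀ : ∀ {U Y} → M , U ⊨ χ 2 c₀ → R M i₁ U Y → ρ Y wy → ¬ V M Y p ≡ true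
    ¬p-copy-of-wy-near-c₀ sat rY r pY
      with χ-successor {j = 1} {c₀} sat (⁅⁆-nonempty i₁) (RB-⁅⁆⁺ M i₁ rY)
    ... | v , rb₀ , sat₁ with q-in-a₁-class-of-c₀ v (RB-⁅⁆⁻ M₀ i₁ rb₀) (q-clash 1 v sat₁ r)
    ... | inj₁ refl = ¬χ₁wx-at-wy r sat₁
    ... | inj₂ refl with trans (sym (p-χ 1 wy sat₁)) pY
    ... | ()

    ¬χ₂c₀-at-c₀ : ∀ {U} → ρ U c₀ → ¬ M , U ⊨ χ 2 c₀
    ¬χ₂c₀-at-c₀ {U} r sat with descend 1 c₀ wx r sat (⁅⁆-nonempty i₁) (RB-⁅⁆⁺ M₁ i₁ refl)
    ... | X , v , rb , r' , rb₀ , sat₁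
      with q-in-a₁-class-of-c₀ v (RB-⁅⁆⁻ M₀ i₁ rb₀) (q-clash 1 v sat₁ r')
    ... | inj₂ refl = ¬χ₁wy-at-wx r' sat₁
    ... | inj₁ refl =
      let Y , rXY , rY , pY = wx-reaches-p-copy-of-wy r' sat₁
      in  ¬p-copy-of-wy-near-c₀ sat (M-trans i₁ U X Y (RB-⁅⁆⁻ M i₁ rb) rXY) rY pY

    walk : ∀ d {U} → ρ U (pt (chain d)) → ¬ M , U ⊨ χ (2 + d) (pt (chain d))
    walk zero = ¬χ₂c₀-at-c₀
    walk (suc d) r sat with step-back (chain d)
    ... | i , edge₁ , back
      with descend (2 + d) (pt (chain (suc d))) (pt (chain d)) r sat (⁅⁆-nonempty i) (RB-⁅⁆⁺ M₁ i edge₁)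
    ... | _ , v , _ , r' , rb₀ , sat' with back v (RB-⁅⁆⁻ M₀ i rb₀) (q-clash (2 + d) v sat' r')
    ... | refl = walk d r' sat'

  no-K45-preimage : ∀ d → ¬ K45Preimage p (χ (2 + d) (pt (chain d))) M₁ (pt (chain d))
  no-K45-preimage d (M , s , (M-trans , _) , sat , ρ , ρs , agree , zig , zag) =
    Refutation.walk M M-trans ρ agree zig zag d ρs sat

  ⊨forget-χ-chain : ∀ d → M₁ , pt (chain d) ⊨ forgetSyn p (χ (2 + d) (pt (chain d)))
  ⊨forget-χ-chain d =
    ⊨forget-χ (2 + d) (M₁≈M₀ (2 + d) (pt (chain d)) (≤-reflexive (sym (depth-chain d))))

proposition5p1 : (n : ℕ) → 3 ≤ n → (p q : ℕ) → p ≢ q → (k : ℕ) → 2 ≤ k →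
    Σ (Form n) λ δ →
      InDL S5nD (p ∷ q ∷ []) k δ ×
      Σ (Model n) λ M' → Σ (S M') λ s' →
        IsModel S5nD M' ×
        M' , s' ⊨ forgetSyn p δ ×
        ¬ (Σ (Model n) λ M → Σ (S M) λ s →
             IsModel K45nD M × M , s ⊨ δ × CollBisim p M s M' s') ×
        ((L : Logic) → ¬ IsForgetResult L p δ (forgetSyn p δ))
proposition5p1 (suc (suc (suc n'))) (s≤s (s≤s (s≤s _))) p q p≢q (suc (suc d)) (s≤s (s≤s _)) =
    χ k root
  , (χ∈D k root , M₀ , root , M₀-S5 , ⊨χ k root)
  , M₁ , root , M₁-S5 , ⊨forget-χ-chain d , no-K45-preimage d
  , λ L → ¬IsForgetResult L M₁-S5 (⊨forget-χ-chain d) (no-K45-preimage d)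
  where
  open Counterexample n' p q p≢q
  k    = 2 + d
  root = pt (chain d)
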